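{- For any $u,v\in S_n$ there exists a sequence $\mathbf{a}\in[n]^n$ such that $u\le_{\mathbf{a}}v$. Furthermore, there exists a sequence $\mathbf{a}\in[n]^n$ such that $u\lesssim_{\mathbf{a}}v$.
   Context: Permutations are in one-line notation $w=w_1\cdots w_n$, $w[k]:=\{w_1,\dots,w_k\}$. For $a,b\in[n]$ the cyclic interval $[a,b)_c$ is $\{a,a+1,\dots,b-1\}$ if $a\le b$ (so $[a,a)_c=\emptyset$) and $\{a,\dots,n\}\cup\{1,\dots,b-1\}$ if $a>b$. For $r\in[n]$ the shifted linear order $<_r$ on $[n]$ is $r<_r r+1<_r\cdots<_r n<_r 1<_r\cdots<_r r-1$. For $k$-subsets $A=\{a_1<_r\cdots<_r a_k\}$ and $B=\{b_1<_r\cdots<_r b_k\}$ of $[n]$, $A\le_r B$ (shifted Gale order) means $a_i\le_r b_i$ for all $i$. For $\mathbf{a}=(a_1,\dots,a_n)\in[n]^n$: $u\le_{\mathbf{a}}v$ means $u[k]\le_{a_k}v[k]$ for all $k\in[n]$; $u\sim_{\mathbf{a}}v$ means $|u[k]\cap[a_k,a_{k+1})_c|=|v[k]\cap[a_k,a_{k+1})_c|$ for all $k\in[n-1]$; and $u\lesssim_{\mathbf{a}}v$ means both $u\le_{\mathbf{a}}v$ and $u\sim_{\mathbf{a}}v$. -}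

module Defs where

open import Data.Nat as ℕ using (ℕ; suc; _≤ᵇ_; _<ᵇ_)
open import Data.Fin as Fin using (Fin; toℕ)
open import Data.Fin.Permutation using (Permutation′; _⟨$⟩ʳ_)
open import Data.Bool using (Bool; true; false; if_then_else_; _∧_; _∨_; not)
open import Data.List using (List; []; _∷_; map; filterᵇ; length; _++_; allFin)
open import Data.Bool.ListAction using (any)
open import Data.List.Relation.Binary.Pointwise using (Pointwise)
open import Data.Product using (_×_)
open import Relation.Binary.PropositionalEquality using (_≡_)

-- Convention: the paper's [n] = {1,…,n} is represented by Fin n = {0,…,n-1},
-- the element i ∈ [n] being represented by i-1.  All notions below are
-- invariant under this uniform shift.

_==_ : ∀ {n} → Fin n → Fin n → Bool
x == y = toℕ x ℕ.≡ᵇ toℕ y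

-- w[k] = {w_1,…,w_k} as a list, for k ∈ [n] (index k : Fin n stands for k+1):
-- the values w(i) for positions i with i ≤ k (0-indexed).
prefix : ∀ {n} → Permutation′ n → Fin n → List (Fin n)
prefix w k = map (w ⟨$⟩ʳ_) (filterᵇ (λ i → toℕ i ≤ᵇ toℕ k) (allFin _))

_∈ᵇ_ : ∀ {n} → Fin n → List (Fin n) → Bool
x ∈ᵇ xs = any (x ==_) xs

-- All elements of [n] listed in the shifted order <_r :
-- r, r+1, …, n, 1, …, r-1.
shiftedEnum : ∀ {n} → Fin n → List (Fin n)
shiftedEnum r = filterᵇ (λ x → toℕ r ≤ᵇ toℕ x) (allFin _)
             ++ filterᵇ (λ x → toℕ x <ᵇ toℕ r) (allFin _)

-- Position of x in the shifted order <_r (0 for r itself).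
rank : ∀ {n} → Fin n → Fin n → ℕ
rank {n} r x = if toℕ r ≤ᵇ toℕ x then toℕ x ℕ.∸ toℕ r else (toℕ x ℕ.+ n) ℕ.∸ toℕ r

_≤[_]_ : ∀ {n} → Fin n → Fin n → Fin n → Set
x ≤[ r ] y = rank r x ℕ.≤ rank r y

sortedBy : ∀ {n} → Fin n → List (Fin n) → List (Fin n)
sortedBy r A = filterᵇ (λ x → x ∈ᵇ A) (shiftedEnum r)

GaleLe : ∀ {n} → Fin n → List (Fin n) → List (Fin n) → Set
GaleLe r A B = Pointwise (λ a b → a ≤[ r ] b) (sortedBy r A) (sortedBy r B)

_≤⟨_⟩_ : ∀ {n} → Permutation′ n → (Fin n → Fin n) → Permutation′ n → Set
u ≤⟨ a ⟩ v = ∀ k → GaleLe (a k) (prefix u k) (prefix v k)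

inCyc : ∀ {n} → Fin n → Fin n → Fin n → Bool
inCyc a b x =
  if toℕ a ≤ᵇ toℕ b
  then (toℕ a ≤ᵇ toℕ x) ∧ (toℕ x <ᵇ toℕ b)
  else (toℕ a ≤ᵇ toℕ x) ∨ (toℕ x <ᵇ toℕ b)

countCyc : ∀ {n} → Fin n → Fin n → List (Fin n) → ℕ
countCyc a b A = length (filterᵇ (inCyc a b) A)

_∼⟨_⟩_ : ∀ {n} → Permutation′ n → (Fin n → Fin n) → Permutation′ n → Set
u ∼⟨ a ⟩ v = ∀ (k k' : Fin _) → toℕ k' ≡ suc (toℕ k) →
  countCyc (a k) (a k') (prefix u k) ≡ countCyc (a k) (a k') (prefix v k)

_≲⟨_⟩_ : ∀ {n} → Permutation′ n → (Fin n → Fin n) → Permutation′ n → Set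
u ≲⟨ a ⟩ v = (u ≤⟨ a ⟩ v) × (u ∼⟨ a ⟩ v)

{-# OPTIONS --safe #-}
module Submission where

-- Fix a position k and put S = u[k], T = v[k] (values in {0,…,n-1}). The potential
-- φ(t) = |S ∩ [0,t)| + |T ∩ [t,n)|, for 0 ≤ t ≤ n, takes the same value at 0 and at n, and
-- counting S and T on a cyclic interval gives |S ∩ [a,b)_c| - |T ∩ [a,b)_c| = φ(b) - φ(a);
-- likewise the number of elements ≤_r y in S minus that in T is φ(y+1) - φ(r). So if r minimises
-- φ then T never has more elements ≤_r y than S, which is the counting form of S ≤_r T; and if
-- two points minimise φ, S and T meet the cyclic interval between them equally often.
-- Going from u[k-1], v[k-1] to u[k], v[k] adds [u_k < t] + [t ≤ v_k] to the potential, a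
-- function of oscillation at most 1; hence a minimiser of φ_{k-1} + φ_k minimises both, and
-- choosing a_k this way makes a_k and a_{k+1} both minimise φ_k.

open import Data.Bool using (Bool; true; false; T; not; _∧_)
open import Data.Bool.ListAction using (any)
open import Data.Bool.Properties using (∧-comm)
open import Data.Fin as Fin using (Fin; toℕ)
open import Data.Fin.Permutation using (Permutation′; _⟨$⟩ʳ_; _⟨$⟩ˡ_; inverseˡ)
open import Data.Fin.Properties using (toℕ<n; toℕ-fromℕ<)
open import Data.List using (List; []; _∷_; _++_; map; filterᵇ; length; tabulate; allFin)
open import Data.List.Membership.Propositional.Properties using (∈-allFin)
import Data.List.Properties as List
open import Data.List.Relation.Binary.Pointwise using (Pointwise; []; _∷_)
open import Data.List.Relation.Unary.All as All using (All; []; _∷_)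
import Data.List.Relation.Unary.All.Properties as All
open import Data.List.Relation.Unary.AllPairs using (AllPairs; []; _∷_)
import Data.List.Relation.Unary.AllPairs.Properties as AllPairs
open import Data.Nat using (ℕ; zero; suc; _+_; _∸_; _≤_; _<_; _≤ᵇ_; _<ᵇ_; _≡ᵇ_; z≤n; s≤s; s≤s⁻¹)
open import Data.Nat.Properties
open import Algebra.Properties.CommutativeMonoid.Sum +-0-commutativeMonoid
  using (sum; sum-permute; sum-replicate-zero)
open import Algebra.Properties.CommutativeSemigroup +-commutativeSemigroup
  using (interchange; x∙yz≈yx∙z; xy∙z≈y∙xz; xy∙z≈xz∙y)
open import Data.List.Extrema ≤-totalOrder using (argmin; f[argmin]≤f[xs])
open import Data.Product using (_×_; _,_; proj₁; proj₂; ∃)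
open import Data.Sum using (inj₁; inj₂)
open import Function using (_∘_)
open import Relation.Binary.PropositionalEquality
open import Relation.Nullary using (¬_; yes; no; contradiction)
open import Relation.Nullary.Decidable using (T?)
open import Relation.Nullary.Reflects using (ofʸ; ofⁿ)

open import Defs hiding (_≤⟨_⟩_)

⟦_⟧ : Bool → ℕ
⟦ true ⟧  = 1
⟦ false ⟧ = 0

count : ∀ {A : Set} → (A → Bool) → List A → ℕ
count p xs = length (filterᵇ p xs)

module _ {A : Set} where

  count-∷ : ∀ (p : A → Bool) x xs → count p (x ∷ xs) ≡ ⟦ p x ⟧ + count p xs
  count-∷ p x xs with p x
  ... | true  = refl
  ... | false = refl

  count-cong : ∀ {p q : A → Bool} → (∀ x → p x ≡ q x) → ∀ xs → count p xs ≡ count q xs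
  count-cong eq [] = refl
  count-cong {p} {q} eq (x ∷ xs) = begin
    count p (x ∷ xs)       ≡⟨ count-∷ p x xs ⟩
    ⟦ p x ⟧ + count p xs   ≡⟨ cong₂ _+_ (cong ⟦_⟧ (eq x)) (count-cong eq xs) ⟩
    ⟦ q x ⟧ + count q xs   ≡⟨ count-∷ q x xs ⟨
    count q (x ∷ xs)       ∎
    where open ≡-Reasoning

  count-pointwise : ∀ {p q p′ q′ : A → Bool} →
    (∀ x → ⟦ p x ⟧ + ⟦ q x ⟧ ≡ ⟦ p′ x ⟧ + ⟦ q′ x ⟧) →
    ∀ xs → count p xs + count q xs ≡ count p′ xs + count q′ xs
  count-pointwise eq [] = refl
  count-pointwise {p} {q} {p′} {q′} eq (x ∷ xs) = begin
    count p (x ∷ xs) + count q (x ∷ xs)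
      ≡⟨ cong₂ _+_ (count-∷ p x xs) (count-∷ q x xs) ⟩
    (⟦ p x ⟧ + count p xs) + (⟦ q x ⟧ + count q xs)
      ≡⟨ interchange ⟦ p x ⟧ _ _ _ ⟩
    (⟦ p x ⟧ + ⟦ q x ⟧) + (count p xs + count q xs)
      ≡⟨ cong₂ _+_ (eq x) (count-pointwise eq xs) ⟩
    (⟦ p′ x ⟧ + ⟦ q′ x ⟧) + (count p′ xs + count q′ xs)
      ≡⟨ interchange ⟦ p′ x ⟧ _ _ _ ⟩
    (⟦ p′ x ⟧ + count p′ xs) + (⟦ q′ x ⟧ + count q′ xs)
      ≡⟨ cong₂ _+_ (count-∷ p′ x xs) (count-∷ q′ x xs) ⟨
    count p′ (x ∷ xs) + count q′ (x ∷ xs)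
      ∎
    where open ≡-Reasoning

  count-false : ∀ xs → count {A} (λ _ → false) xs ≡ 0
  count-false []       = refl
  count-false (x ∷ xs) = count-false xs

  count-true : ∀ xs → count {A} (λ _ → true) xs ≡ length xs
  count-true []       = refl
  count-true (x ∷ xs) = cong suc (count-true xs)

  count-split : ∀ {p q r : A → Bool} → (∀ x → ⟦ p x ⟧ ≡ ⟦ q x ⟧ + ⟦ r x ⟧) →
    ∀ xs → count p xs ≡ count q xs + count r xs
  count-split {p} {q} {r} eq xs = begin
    count p xs                            ≡⟨ +-identityʳ (count p xs) ⟨
    count p xs + 0                        ≡⟨ cong (count p xs +_) (count-false xs) ⟨
    count p xs + count (λ _ → false) xs   ≡⟨ count-pointwise (λ x → trans (+-identityʳ _) (eq x)) xs ⟩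
    count q xs + count r xs               ∎
    where open ≡-Reasoning

  count-const : ∀ b {xs ys : List A} → length xs ≡ length ys → count (λ _ → b) xs ≡ count (λ _ → b) ys
  count-const true  {xs} {ys} eq = trans (count-true xs) (trans eq (sym (count-true ys)))
  count-const false {xs} {ys} _  = trans (count-false xs) (sym (count-false ys))

  count-++ : ∀ (p : A → Bool) xs ys → count p (xs ++ ys) ≡ count p xs + count p ys
  count-++ p xs ys = trans (cong length (List.filter-++ (T? ∘ p) xs ys)) (List.length-++ (filterᵇ p xs))

  count-filter : ∀ (p q : A → Bool) xs → count p (filterᵇ q xs) ≡ count (λ x → q x ∧ p x) xs
  count-filter p q [] = refl
  count-filter p q (x ∷ xs) = begin
    count p (filterᵇ q (x ∷ xs))                 ≡⟨ head-step ⟩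
    ⟦ q x ∧ p x ⟧ + count p (filterᵇ q xs)       ≡⟨ cong (⟦ q x ∧ p x ⟧ +_) (count-filter p q xs) ⟩
    ⟦ q x ∧ p x ⟧ + count (λ x → q x ∧ p x) xs   ≡⟨ count-∷ (λ x → q x ∧ p x) x xs ⟨
    count (λ x → q x ∧ p x) (x ∷ xs)             ∎
    where
    open ≡-Reasoning
    head-step : count p (filterᵇ q (x ∷ xs)) ≡ ⟦ q x ∧ p x ⟧ + count p (filterᵇ q xs)
    head-step with q x
    ... | true  = count-∷ p x _
    ... | false = refl

  any≡0<ᵇcount : ∀ (p : A → Bool) xs → any p xs ≡ (0 <ᵇ count p xs)
  any≡0<ᵇcount p [] = refl
  any≡0<ᵇcount p (x ∷ xs) with p x
  ... | true  = refl
  ... | false = any≡0<ᵇcount p xs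

  count-accept : ∀ (p : A → Bool) {x} xs → T (p x) → count p (x ∷ xs) ≡ suc (count p xs)
  count-accept p xs px = cong length (List.filter-accept (T? ∘ p) px)

  count-none : ∀ {p : A → Bool} {xs} → All (λ x → ¬ T (p x)) xs → count p xs ≡ 0
  count-none {p} ¬pxs = cong length (List.filter-none (T? ∘ p) ¬pxs)

count-map : ∀ {A B : Set} (p : B → Bool) (f : A → B) xs → count p (map f xs) ≡ count (p ∘ f) xs
count-map p f [] = refl
count-map p f (x ∷ xs) =
  trans (count-∷ p (f x) _) (trans (cong (⟦ p (f x) ⟧ +_) (count-map p f xs)) (sym (count-∷ (p ∘ f) x xs)))

count-tabulate : ∀ {A : Set} {n} (p : A → Bool) (f : Fin n → A) →
  count p (tabulate f) ≡ sum (λ i → ⟦ p (f i) ⟧)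
count-tabulate {n = zero}  p f = refl
count-tabulate {n = suc n} p f =
  trans (count-∷ p (f Fin.zero) _) (cong (⟦ p (f Fin.zero) ⟧ +_) (count-tabulate p (f ∘ Fin.suc)))

count-allFin-∘-permutation : ∀ {n} (σ : Permutation′ n) (p : Fin n → Bool) →
  count (p ∘ (σ ⟨$⟩ʳ_)) (allFin n) ≡ count p (allFin n)
count-allFin-∘-permutation {n} σ p = begin
  count (p ∘ (σ ⟨$⟩ʳ_)) (allFin n)   ≡⟨ count-tabulate (p ∘ (σ ⟨$⟩ʳ_)) (λ i → i) ⟩
  sum {n} (λ i → ⟦ p (σ ⟨$⟩ʳ i) ⟧)   ≡⟨ sum-permute (⟦_⟧ ∘ p) σ ⟨
  sum {n} (λ i → ⟦ p i ⟧)            ≡⟨ count-tabulate p (λ i → i) ⟨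
  count p (allFin n)                 ∎
  where open ≡-Reasoning

count-allFin-at : ∀ {n} (j : Fin n) (p : Fin n → Bool) →
  count (λ i → (j == i) ∧ p i) (allFin n) ≡ ⟦ p j ⟧
count-allFin-at j p = trans (count-tabulate (λ i → (j == i) ∧ p i) (λ i → i)) (sum-at j p)
  where
  sum-at : ∀ {n} (j : Fin n) (p : Fin n → Bool) → sum (λ i → ⟦ (j == i) ∧ p i ⟧) ≡ ⟦ p j ⟧
  sum-at {suc n} Fin.zero    p = trans (cong (⟦ p Fin.zero ⟧ +_) (sum-replicate-zero n)) (+-identityʳ _)
  sum-at         (Fin.suc j) p = sum-at j (p ∘ Fin.suc)

≤ᵇ-true : ∀ {m n} → m ≤ n → (m ≤ᵇ n) ≡ true
≤ᵇ-true {m} {n} m≤n with m ≤ᵇ n | ≤ᵇ-reflects-≤ m n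
... | true  | _       = refl
... | false | ofⁿ m≰n = contradiction m≤n m≰n

≤ᵇ-false : ∀ {m n} → n < m → (m ≤ᵇ n) ≡ false
≤ᵇ-false {m} {n} n<m with m ≤ᵇ n | ≤ᵇ-reflects-≤ m n
... | true  | ofʸ m≤n = contradiction m≤n (<⇒≱ n<m)
... | false | _       = refl

≤ᵇ-≡ : ∀ {m n m′ n′} → (m ≤ n → m′ ≤ n′) → (m′ ≤ n′ → m ≤ n) →
  (m ≤ᵇ n) ≡ (m′ ≤ᵇ n′)
≤ᵇ-≡ {m} {n} to from with m ≤ᵇ n | ≤ᵇ-reflects-≤ m n
... | true  | ofʸ m≤n = sym (≤ᵇ-true (to m≤n))
... | false | ofⁿ m≰n = sym (≤ᵇ-false (≰⇒> (m≰n ∘ from)))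

<ᵇ≡not-≤ᵇ : ∀ m n → (m <ᵇ n) ≡ not (n ≤ᵇ m)
<ᵇ≡not-≤ᵇ m n with n ≤ᵇ m | ≤ᵇ-reflects-≤ n m
... | true  | ofʸ n≤m = ≤ᵇ-false {suc m} (s≤s n≤m)
... | false | ofⁿ n≰m = ≤ᵇ-true {suc m} (≰⇒> n≰m)

≤ᵇ≡<ᵇsuc : ∀ m n → (m ≤ᵇ n) ≡ (m <ᵇ suc n)
≤ᵇ≡<ᵇsuc zero    n = refl
≤ᵇ≡<ᵇsuc (suc m) n = refl

<ᵇsuc-split : ∀ m n c → ⟦ (m <ᵇ suc n) ∧ c ⟧ ≡ ⟦ (m <ᵇ n) ∧ c ⟧ + ⟦ (n ≡ᵇ m) ∧ c ⟧
<ᵇsuc-split zero    zero    c = refl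
<ᵇsuc-split zero    (suc n) c = sym (+-identityʳ ⟦ c ⟧)
<ᵇsuc-split (suc m) zero    c = refl
<ᵇsuc-split (suc m) (suc n) c = <ᵇsuc-split m n c

0<ᵇ⟦⟧ : ∀ b → (0 <ᵇ ⟦ b ⟧) ≡ b
0<ᵇ⟦⟧ true  = refl
0<ᵇ⟦⟧ false = refl

⟦⟧≤1 : ∀ b → ⟦ b ⟧ ≤ 1
⟦⟧≤1 true  = ≤-refl
⟦⟧≤1 false = z≤n

⟦not⟧-anti : ∀ {b c} → ⟦ b ⟧ ≤ ⟦ c ⟧ → ⟦ not c ⟧ ≤ ⟦ not b ⟧
⟦not⟧-anti {false} {c}    _ = ⟦⟧≤1 (not c)
⟦not⟧-anti {true}  {true} _ = z≤n

⟦<ᵇ⟧-monoʳ : ∀ a {s t} → s ≤ t → ⟦ a <ᵇ s ⟧ ≤ ⟦ a <ᵇ t ⟧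
⟦<ᵇ⟧-monoʳ a {s} {t} s≤t with a <ᵇ s | <ᵇ-reflects-< a s
... | false | _       = z≤n
... | true  | ofʸ a<s rewrite ≤ᵇ-true (<-≤-trans a<s s≤t) = ≤-refl

not-swap : ∀ c d c′ d′ → ⟦ c ⟧ + ⟦ d ⟧ ≡ ⟦ c′ ⟧ + ⟦ d′ ⟧ →
  ⟦ c ⟧ + ⟦ not d′ ⟧ ≡ ⟦ c′ ⟧ + ⟦ not d ⟧
not-swap c true  c′ false eq = eq
not-swap c false c′ true  eq = eq
not-swap c true  c′ true  eq = cong (_+ 0) (+-cancelʳ-≡ 1 ⟦ c ⟧ ⟦ c′ ⟧ eq)
not-swap c false c′ false eq = cong (_+ 1) (+-cancelʳ-≡ 0 ⟦ c ⟧ ⟦ c′ ⟧ eq)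

m∸o≤n∸o⇒m≤n : ∀ {m n o} → o ≤ n → m ∸ o ≤ n ∸ o → m ≤ n
m∸o≤n∸o⇒m≤n {m} {n} {o} o≤n m∸o≤n∸o = begin
  m            ≤⟨ m≤n+m∸n m o ⟩
  o + (m ∸ o)  ≤⟨ +-monoʳ-≤ o m∸o≤n∸o ⟩
  o + (n ∸ o)  ≡⟨ m+[n∸m]≡n o≤n ⟩
  n            ∎
  where open ≤-Reasoning

half-≤ : ∀ {x y} → x + x ≤ suc (y + y) → x ≤ y
half-≤ {x} {y} x+x≤1+y+y = ≮⇒≥ λ y<x →
  1+n≰n (≤-trans (subst (_≤ x + x) (cong suc (+-suc y y)) (+-mono-≤ y<x y<x)) x+x≤1+y+y)

-- Initial segments of a permutation

module _ {n : ℕ} (w : Permutation′ n) where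

  initial : ℕ → List (Fin n)
  initial j = map (w ⟨$⟩ʳ_) (filterᵇ (λ i → toℕ i <ᵇ j) (allFin n))

  prefix≡initial : ∀ k → prefix w k ≡ initial (suc (toℕ k))
  prefix≡initial k = cong (map (w ⟨$⟩ʳ_)) (List.filter-≐ (T? ∘ p) (T? ∘ q)
    ((λ {i} → subst T (p≡q i)) , (λ {i} → subst T (sym (p≡q i)))) (allFin n))
    where
    p q : Fin n → Bool
    p i = toℕ i ≤ᵇ toℕ k
    q i = toℕ i <ᵇ suc (toℕ k)
    p≡q : ∀ i → p i ≡ q i
    p≡q i = ≤ᵇ≡<ᵇsuc (toℕ i) (toℕ k)

  count-initial-positions : ∀ (p : Fin n → Bool) j →
    count p (initial j) ≡ count (λ i → (toℕ i <ᵇ j) ∧ p (w ⟨$⟩ʳ i)) (allFin n)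
  count-initial-positions p j =
    trans (count-map p (w ⟨$⟩ʳ_) (filterᵇ (λ i → toℕ i <ᵇ j) (allFin n))) (count-filter _ _ (allFin n))

  count-initial : ∀ (p : Fin n → Bool) j →
    count p (initial j) ≡ count (λ x → (toℕ (w ⟨$⟩ˡ x) <ᵇ j) ∧ p x) (allFin n)
  count-initial p j = begin
    count p (initial j)
      ≡⟨ count-initial-positions p j ⟩
    count (λ i → (toℕ i <ᵇ j) ∧ p (w ⟨$⟩ʳ i)) (allFin n)
      ≡⟨ count-cong (λ i → cong (λ i′ → (toℕ i′ <ᵇ j) ∧ p (w ⟨$⟩ʳ i)) (sym (inverseˡ w))) (allFin n) ⟩
    count ((λ x → (toℕ (w ⟨$⟩ˡ x) <ᵇ j) ∧ p x) ∘ (w ⟨$⟩ʳ_)) (allFin n)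
      ≡⟨ count-allFin-∘-permutation w _ ⟩
    count (λ x → (toℕ (w ⟨$⟩ˡ x) <ᵇ j) ∧ p x) (allFin n)
      ∎
    where open ≡-Reasoning

  ∈ᵇ-initial : ∀ x j → (x ∈ᵇ initial j) ≡ (toℕ (w ⟨$⟩ˡ x) <ᵇ j)
  ∈ᵇ-initial x j = begin
    any (x ==_) (initial j)
      ≡⟨ any≡0<ᵇcount (x ==_) (initial j) ⟩
    (0 <ᵇ count (x ==_) (initial j))
      ≡⟨ cong (0 <ᵇ_) (count-initial (x ==_) j) ⟩
    (0 <ᵇ count (λ y → (toℕ (w ⟨$⟩ˡ y) <ᵇ j) ∧ (x == y)) (allFin n))
      ≡⟨ cong (0 <ᵇ_) (count-cong (λ y → ∧-comm _ (x == y)) (allFin n)) ⟩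
    (0 <ᵇ count (λ y → (x == y) ∧ (toℕ (w ⟨$⟩ˡ y) <ᵇ j)) (allFin n))
      ≡⟨ cong (0 <ᵇ_) (count-allFin-at x _) ⟩
    (0 <ᵇ ⟦ toℕ (w ⟨$⟩ˡ x) <ᵇ j ⟧)
      ≡⟨ 0<ᵇ⟦⟧ _ ⟩
    (toℕ (w ⟨$⟩ˡ x) <ᵇ j)
      ∎
    where open ≡-Reasoning

  count-initial-suc : ∀ (p : Fin n → Bool) k →
    count p (initial (suc (toℕ k))) ≡ count p (initial (toℕ k)) + ⟦ p (w ⟨$⟩ʳ k) ⟧
  count-initial-suc p k = begin
    count p (initial (suc (toℕ k)))
      ≡⟨ count-initial-positions p (suc (toℕ k)) ⟩
    count (λ i → (toℕ i <ᵇ suc (toℕ k)) ∧ p (w ⟨$⟩ʳ i)) (allFin n)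
      ≡⟨ count-split (λ i → <ᵇsuc-split (toℕ i) (toℕ k) (p (w ⟨$⟩ʳ i))) (allFin n) ⟩
    count (λ i → (toℕ i <ᵇ toℕ k) ∧ p (w ⟨$⟩ʳ i)) (allFin n)
      + count (λ i → (k == i) ∧ p (w ⟨$⟩ʳ i)) (allFin n)
      ≡⟨ cong₂ _+_ (sym (count-initial-positions p (toℕ k))) (count-allFin-at k _) ⟩
    count p (initial (toℕ k)) + ⟦ p (w ⟨$⟩ʳ k) ⟧
      ∎
    where open ≡-Reasoning

-- The shifted order

AllPairs-restrict : ∀ {A : Set} {R S : A → A → Set} {P : A → Set} {xs} →
  (∀ {x y} → P x → P y → R x y → S x y) → All P xs → AllPairs R xs → AllPairs S xs
AllPairs-restrict f []         []         = []
AllPairs-restrict f (px ∷ pxs) (rx ∷ rxs) =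
  All.zipWith (λ (py , rxy) → f px py rxy) (pxs , rx) ∷ AllPairs-restrict f pxs rxs

filterᵇ-allFin-sorted : ∀ {n} {S : Fin n → Fin n → Set} (p : Fin n → Bool) →
  (∀ {x y} → T (p x) → T (p y) → toℕ x < toℕ y → S x y) → AllPairs S (filterᵇ p (allFin n))
filterᵇ-allFin-sorted {n} p f = AllPairs-restrict f
  (All.all-filter (T? ∘ p) (allFin n))
  (AllPairs.filter⁺ (T? ∘ p) (AllPairs.tabulate⁺-< (λ i<j → i<j)))

module _ {n : ℕ} (r : Fin n) where

  rank-≥ : ∀ {x} → T (toℕ r ≤ᵇ toℕ x) → rank r x ≡ toℕ x ∸ toℕ r
  rank-≥ {x} r≤x rewrite ≤ᵇ-true (≤ᵇ⇒≤ (toℕ r) (toℕ x) r≤x) = refl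

  rank-< : ∀ {x} → T (toℕ x <ᵇ toℕ r) → rank r x ≡ toℕ x + n ∸ toℕ r
  rank-< {x} x<r rewrite ≤ᵇ-false (<ᵇ⇒< (toℕ x) (toℕ r) x<r) = refl

  shiftedEnum-sorted : AllPairs (λ x y → rank r x ≤ rank r y) (shiftedEnum r)
  shiftedEnum-sorted = AllPairs.++⁺
    (filterᵇ-allFin-sorted _ λ r≤x r≤y x<y →
      subst₂ _≤_ (sym (rank-≥ r≤x)) (sym (rank-≥ r≤y)) (∸-monoˡ-≤ (toℕ r) (<⇒≤ x<y)))
    (filterᵇ-allFin-sorted _ λ x<r y<r x<y →
      subst₂ _≤_ (sym (rank-< x<r)) (sym (rank-< y<r)) (∸-monoˡ-≤ (toℕ r) (+-monoˡ-≤ n (<⇒≤ x<y))))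
    (All.map (λ {x} r≤x → All.map (λ {y} y<r →
        subst₂ _≤_ (sym (rank-≥ r≤x)) (sym (rank-< y<r))
          (∸-monoˡ-≤ (toℕ r) (≤-trans (<⇒≤ (toℕ<n x)) (m≤n+m n (toℕ y)))))
      (All.all-filter _ (allFin n)))
      (All.all-filter _ (allFin n)))

  count-shiftedEnum : ∀ p → count p (shiftedEnum r) ≡ count p (allFin n)
  count-shiftedEnum p = begin
    count p (shiftedEnum r)
      ≡⟨ count-++ p (filterᵇ (λ x → toℕ r ≤ᵇ toℕ x) (allFin n)) _ ⟩
    count p (filterᵇ (λ x → toℕ r ≤ᵇ toℕ x) (allFin n))
      + count p (filterᵇ (λ x → toℕ x <ᵇ toℕ r) (allFin n))
      ≡⟨ cong₂ _+_ (count-filter p _ (allFin n)) (count-filter p _ (allFin n)) ⟩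
    count (λ x → (toℕ r ≤ᵇ toℕ x) ∧ p x) (allFin n)
      + count (λ x → (toℕ x <ᵇ toℕ r) ∧ p x) (allFin n)
      ≡⟨ count-split split (allFin n) ⟨
    count p (allFin n)
      ∎
    where
    open ≡-Reasoning
    split : ∀ x → ⟦ p x ⟧ ≡ ⟦ (toℕ r ≤ᵇ toℕ x) ∧ p x ⟧ + ⟦ (toℕ x <ᵇ toℕ r) ∧ p x ⟧
    split x rewrite <ᵇ≡not-≤ᵇ (toℕ x) (toℕ r) with toℕ r ≤ᵇ toℕ x
    ... | true  = sym (+-identityʳ ⟦ p x ⟧)
    ... | false = refl

  sortedBy-sorted : ∀ A → AllPairs (λ x y → rank r x ≤ rank r y) (sortedBy r A)
  sortedBy-sorted A = AllPairs.filter⁺ (T? ∘ (_∈ᵇ A)) shiftedEnum-sorted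

  count-sortedBy-initial : ∀ (w : Permutation′ n) j p →
    count p (sortedBy r (initial w j)) ≡ count p (initial w j)
  count-sortedBy-initial w j p = begin
    count p (sortedBy r (initial w j))
      ≡⟨ count-filter p _ (shiftedEnum r) ⟩
    count (λ x → (x ∈ᵇ initial w j) ∧ p x) (shiftedEnum r)
      ≡⟨ count-shiftedEnum _ ⟩
    count (λ x → (x ∈ᵇ initial w j) ∧ p x) (allFin n)
      ≡⟨ count-cong (λ x → cong (_∧ p x) (∈ᵇ-initial w x j)) (allFin n) ⟩
    count (λ x → (toℕ (w ⟨$⟩ˡ x) <ᵇ j) ∧ p x) (allFin n)
      ≡⟨ count-initial w p j ⟨
    count p (initial w j)
      ∎
    where open ≡-Reasoning

  length-sortedBy-initial : ∀ (w : Permutation′ n) j →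
    length (sortedBy r (initial w j)) ≡ length (initial w j)
  length-sortedBy-initial w j = begin
    length (sortedBy r (initial w j))             ≡⟨ count-true (sortedBy r (initial w j)) ⟨
    count (λ _ → true) (sortedBy r (initial w j)) ≡⟨ count-sortedBy-initial w j _ ⟩
    count (λ _ → true) (initial w j)              ≡⟨ count-true (initial w j) ⟩
    length (initial w j)                          ∎
    where open ≡-Reasoning

inCyc-identity : ∀ {n} (a b x : Fin n) →
  ⟦ inCyc a b x ⟧ + ⟦ toℕ x <ᵇ toℕ a ⟧ ≡ ⟦ toℕ b <ᵇ toℕ a ⟧ + ⟦ toℕ x <ᵇ toℕ b ⟧
inCyc-identity a b x
  rewrite <ᵇ≡not-≤ᵇ (toℕ x) (toℕ a) | <ᵇ≡not-≤ᵇ (toℕ b) (toℕ a)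
  with toℕ a ≤ᵇ toℕ b | ≤ᵇ-reflects-≤ (toℕ a) (toℕ b)
     | toℕ a ≤ᵇ toℕ x | ≤ᵇ-reflects-≤ (toℕ a) (toℕ x)
     | toℕ x <ᵇ toℕ b | <ᵇ-reflects-< (toℕ x) (toℕ b)
... | true  | _       | true  | _       | true  | _       = refl
... | true  | _       | true  | _       | false | _       = refl
... | true  | _       | false | _       | true  | _       = refl
... | true  | ofʸ a≤b | false | ofⁿ a≰x | false | ofⁿ x≮b =
  contradiction (<-≤-trans (≰⇒> a≰x) a≤b) x≮b
... | false | ofⁿ a≰b | true  | ofʸ a≤x | true  | ofʸ x<b =
  contradiction (<⇒≤ (≤-<-trans a≤x x<b)) a≰b
... | false | _       | true  | _       | false | _       = refl
... | false | _       | false | _       | true  | _       = refl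
... | false | _       | false | _       | false | _       = refl

rank-identity : ∀ {n} (r x y : Fin n) →
  ⟦ rank r x ≤ᵇ rank r y ⟧ + ⟦ toℕ x <ᵇ toℕ r ⟧
    ≡ ⟦ toℕ y <ᵇ toℕ r ⟧ + ⟦ toℕ x <ᵇ suc (toℕ y) ⟧
rank-identity {n} r x y
  rewrite <ᵇ≡not-≤ᵇ (toℕ x) (toℕ r) | <ᵇ≡not-≤ᵇ (toℕ y) (toℕ r)
  with toℕ r ≤ᵇ toℕ x | ≤ᵇ-reflects-≤ (toℕ r) (toℕ x)
     | toℕ r ≤ᵇ toℕ y | ≤ᵇ-reflects-≤ (toℕ r) (toℕ y)
... | true  | ofʸ r≤x | true  | ofʸ r≤y = trans (+-identityʳ _)
  (cong ⟦_⟧ (≤ᵇ-≡ (s≤s ∘ m∸o≤n∸o⇒m≤n r≤y) (∸-monoˡ-≤ (toℕ r) ∘ s≤s⁻¹)))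
... | false | ofⁿ r≰x | false | ofⁿ r≰y =
  trans (+-comm _ 1) (cong (λ b → 1 + ⟦ b ⟧) (≤ᵇ-≡
    (s≤s ∘ +-cancelʳ-≤ n _ _ ∘ m∸o≤n∸o⇒m≤n (≤-trans (<⇒≤ (toℕ<n r)) (m≤n+m n (toℕ y))))
    (∸-monoˡ-≤ (toℕ r) ∘ +-monoˡ-≤ n ∘ s≤s⁻¹)))
... | true  | ofʸ r≤x | false | ofⁿ r≰y
  rewrite ≤ᵇ-true {toℕ x ∸ toℕ r} {toℕ y + n ∸ toℕ r}
            (∸-monoˡ-≤ (toℕ r) (≤-trans (<⇒≤ (toℕ<n x)) (m≤n+m n (toℕ y))))
        | ≤ᵇ-false {suc (toℕ x)} {suc (toℕ y)} (s≤s (<-≤-trans (≰⇒> r≰y) r≤x)) = refl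
... | false | ofⁿ r≰x | true  | ofʸ r≤y
  rewrite ≤ᵇ-false {toℕ x + n ∸ toℕ r} {toℕ y ∸ toℕ r}
            (∸-monoˡ-< (<-≤-trans (toℕ<n y) (m≤n+m n (toℕ x))) r≤y)
        | ≤ᵇ-true {suc (toℕ x)} {suc (toℕ y)} (s≤s (<⇒≤ (<-≤-trans (≰⇒> r≰x) r≤y))) = refl

gale-criterion : ∀ {A : Set} (κ : A → ℕ) {xs ys : List A} →
  AllPairs (λ x y → κ x ≤ κ y) xs → AllPairs (λ x y → κ x ≤ κ y) ys → length xs ≡ length ys →
  (∀ y → count (λ z → κ z ≤ᵇ κ y) ys ≤ count (λ z → κ z ≤ᵇ κ y) xs) →
  Pointwise (λ x y → κ x ≤ κ y) xs ys
gale-criterion     κ {[]}     {[]}     _             _             _   _   = []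
gale-criterion {A} κ {a ∷ xs} {b ∷ ys} (a≤xs ∷ xs↑) (b≤ys ∷ ys↑) len dom =
  a≤b ∷ gale-criterion κ xs↑ ys↑ (suc-injective len) dom′
  where
  at-most : A → A → Bool
  at-most y z = κ z ≤ᵇ κ y
  none-at-most : ∀ {y zs} → All (λ z → κ y < κ z) zs → count (at-most y) zs ≡ 0
  none-at-most = count-none ∘ All.map (λ y<z → <⇒≱ y<z ∘ ≤ᵇ⇒≤ _ _)
  a≤b : κ a ≤ κ b
  a≤b with κ a ≤? κ b
  ... | yes a≤b = a≤b
  ... | no  a≰b = contradiction
    (subst₂ _≤_ (count-accept (at-most b) ys (≤⇒≤ᵇ (≤-refl {κ b})))
                (none-at-most (b<a ∷ All.map (<-≤-trans b<a) a≤xs)) (dom b))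
    λ ()
    where
    b<a : κ b < κ a
    b<a = ≰⇒> a≰b
  dom′ : ∀ y → count (at-most y) ys ≤ count (at-most y) xs
  dom′ y with κ b ≤? κ y
  ... | yes b≤y = s≤s⁻¹ (subst₂ _≤_ (count-accept (at-most y) ys (≤⇒≤ᵇ b≤y))
                                    (count-accept (at-most y) xs (≤⇒≤ᵇ (≤-trans a≤b b≤y))) (dom y))
  ... | no  b≰y = subst (_≤ _) (sym (none-at-most (All.map (<-≤-trans (≰⇒> b≰y)) b≤ys))) z≤n

-- The potential and its minimisers

module _ {n : ℕ} where

  potential : List (Fin n) → List (Fin n) → ℕ → ℕ
  potential S T t = count (λ x → toℕ x <ᵇ t) S + count (λ x → not (toℕ x <ᵇ t)) T

  potential-balance : ∀ (C : Fin n → Bool) (c : Bool) s t →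
    (∀ x → ⟦ C x ⟧ + ⟦ toℕ x <ᵇ s ⟧ ≡ ⟦ c ⟧ + ⟦ toℕ x <ᵇ t ⟧) →
    ∀ S T → length S ≡ length T → count C S + potential S T s ≡ count C T + potential S T t
  potential-balance C c s t identity S T |S|≡|T| = begin
    count C S + (below s S + above s T)
      ≡⟨ +-assoc (count C S) _ _ ⟨
    (count C S + below s S) + above s T
      ≡⟨ cong (_+ above s T) (count-pointwise identity S) ⟩
    (const S + below t S) + above s T
      ≡⟨ cong (λ z → (z + below t S) + above s T) (count-const c {S} {T} |S|≡|T|) ⟩
    (const T + below t S) + above s T
      ≡⟨ xy∙z≈xz∙y (const T) _ _ ⟩
    (const T + above s T) + below t S
      ≡⟨ cong (_+ below t S) (count-pointwise identity′ T) ⟨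
    (count C T + above t T) + below t S
      ≡⟨ xy∙z≈xz∙y (count C T) _ _ ⟩
    (count C T + below t S) + above t T
      ≡⟨ +-assoc (count C T) _ _ ⟩
    count C T + (below t S + above t T)
      ∎
    where
    open ≡-Reasoning
    below above : ℕ → List (Fin n) → ℕ
    below t = count (λ x → toℕ x <ᵇ t)
    above t = count (λ x → not (toℕ x <ᵇ t))
    const : List (Fin n) → ℕ
    const = count (λ _ → c)
    identity′ : ∀ x → ⟦ C x ⟧ + ⟦ not (toℕ x <ᵇ t) ⟧ ≡ ⟦ c ⟧ + ⟦ not (toℕ x <ᵇ s) ⟧
    identity′ x = not-swap (C x) (toℕ x <ᵇ s) c (toℕ x <ᵇ t) (identity x)

  potential-periodic : ∀ S T → length S ≡ length T → potential S T n ≡ potential S T 0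
  potential-periodic S T |S|≡|T| = begin
    count (λ x → toℕ x <ᵇ n) S + count (λ x → not (toℕ x <ᵇ n)) T
      ≡⟨ cong₂ _+_ (count-cong all-below S) (count-cong (cong not ∘ all-below) T) ⟩
    count (λ _ → true) S + count (λ _ → false) T
      ≡⟨ cong₂ _+_ (trans (count-true S) |S|≡|T|) (count-false T) ⟩
    length T + 0
      ≡⟨ +-comm (length T) 0 ⟩
    0 + length T
      ≡⟨ cong₂ _+_ (count-false S) (count-true T) ⟨
    count (λ x → toℕ x <ᵇ 0) S + count (λ x → not (toℕ x <ᵇ 0)) T
      ∎
    where
    open ≡-Reasoning
    all-below : ∀ (x : Fin n) → (toℕ x <ᵇ n) ≡ true
    all-below x = ≤ᵇ-true (toℕ<n x)

increment-oscillation : ∀ a b s t →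
  ⟦ a <ᵇ t ⟧ + ⟦ not (b <ᵇ t) ⟧ ≤ suc (⟦ a <ᵇ s ⟧ + ⟦ not (b <ᵇ s) ⟧)
increment-oscillation a b s t with ≤-total s t
... | inj₁ s≤t = begin
  ⟦ a <ᵇ t ⟧ + ⟦ not (b <ᵇ t) ⟧
    ≤⟨ +-mono-≤ (⟦⟧≤1 (a <ᵇ t)) (⟦not⟧-anti (⟦<ᵇ⟧-monoʳ b s≤t)) ⟩
  suc ⟦ not (b <ᵇ s) ⟧
    ≤⟨ s≤s (m≤n+m _ ⟦ a <ᵇ s ⟧) ⟩
  suc (⟦ a <ᵇ s ⟧ + ⟦ not (b <ᵇ s) ⟧)
    ∎
  where open ≤-Reasoning
... | inj₂ t≤s = begin
  ⟦ a <ᵇ t ⟧ + ⟦ not (b <ᵇ t) ⟧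
    ≤⟨ +-mono-≤ (⟦<ᵇ⟧-monoʳ a t≤s) (⟦⟧≤1 (not (b <ᵇ t))) ⟩
  ⟦ a <ᵇ s ⟧ + 1
    ≡⟨ +-comm ⟦ a <ᵇ s ⟧ 1 ⟩
  suc ⟦ a <ᵇ s ⟧
    ≤⟨ s≤s (m≤m+n ⟦ a <ᵇ s ⟧ _) ⟩
  suc (⟦ a <ᵇ s ⟧ + ⟦ not (b <ᵇ s) ⟧)
    ∎
  where open ≤-Reasoning

common-minimiser : ∀ {A : Set} (f g e : A → ℕ) → (∀ t → g t ≡ f t + e t) →
  (∀ s t → e t ≤ suc (e s)) →
  ∀ m → (∀ t → f m + g m ≤ f t + g t) → (∀ t → f m ≤ f t) × (∀ t → g m ≤ g t)
common-minimiser f g e g≡f+e e-osc m m-min = f-min , g-min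
  where
  open ≤-Reasoning
  f-min : ∀ t → f m ≤ f t
  f-min t = half-≤ (+-cancelʳ-≤ (e m) _ _ (begin
    (f m + f m) + e m          ≡⟨ +-assoc (f m) (f m) (e m) ⟩
    f m + (f m + e m)          ≡⟨ cong (f m +_) (g≡f+e m) ⟨
    f m + g m                  ≤⟨ m-min t ⟩
    f t + g t                  ≡⟨ cong (f t +_) (g≡f+e t) ⟩
    f t + (f t + e t)          ≤⟨ +-monoʳ-≤ (f t) (+-monoʳ-≤ (f t) (e-osc m t)) ⟩
    f t + (f t + suc (e m))    ≡⟨ +-assoc (f t) (f t) (suc (e m)) ⟨
    (f t + f t) + suc (e m)    ≡⟨ +-suc (f t + f t) (e m) ⟩
    suc (f t + f t) + e m      ∎))
  g-min : ∀ t → g m ≤ g t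
  g-min t = half-≤ (begin
    g m + g m                  ≡⟨ cong (g m +_) (g≡f+e m) ⟩
    g m + (f m + e m)          ≡⟨ x∙yz≈yx∙z (g m) (f m) (e m) ⟩
    (f m + g m) + e m          ≤⟨ +-mono-≤ (m-min t) (e-osc t m) ⟩
    (f t + g t) + suc (e t)    ≡⟨ +-suc (f t + g t) (e t) ⟩
    suc ((f t + g t) + e t)    ≡⟨ cong suc (xy∙z≈y∙xz (f t) (g t) (e t)) ⟩
    suc (g t + (f t + e t))    ≡⟨ cong (λ z → suc (g t + z)) (g≡f+e t) ⟨
    suc (g t + g t)            ∎)

minimum-periodic : ∀ {n} (h : ℕ → ℕ) → h n ≡ h 0 → ∀ {r : Fin n} →
  (∀ (t : Fin n) → h (toℕ r) ≤ h (toℕ t)) → ∀ t → t ≤ n → h (toℕ r) ≤ h t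
minimum-periodic {suc n} h h-periodic {r} r-min t t≤n with m≤n⇒m<n∨m≡n t≤n
... | inj₁ t<n  = subst (λ z → h (toℕ r) ≤ h z) (toℕ-fromℕ< t<n) (r-min (Fin.fromℕ< t<n))
... | inj₂ refl = subst (h (toℕ r) ≤_) (sym h-periodic) (r-min Fin.zero)

-- The sequence a

module Construction {n : ℕ} (u v : Permutation′ n) where

  φ : ℕ → ℕ → ℕ
  φ j = potential (initial u j) (initial v j)

  length-initial : ∀ j → length (initial u j) ≡ length (initial v j)
  length-initial j = trans (List.length-map (u ⟨$⟩ʳ_) positions) (sym (List.length-map (v ⟨$⟩ʳ_) positions))
    where
    positions : List (Fin n)
    positions = filterᵇ (λ i → toℕ i <ᵇ j) (allFin n)

  Minimises : (ℕ → ℕ) → Fin n → Set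
  Minimises h r = ∀ (t : Fin n) → h (toℕ r) ≤ h (toℕ t)

  minimiser⇒GaleLe : ∀ j r → Minimises (φ j) r → GaleLe r (initial u j) (initial v j)
  minimiser⇒GaleLe j r r-min = gale-criterion (rank r)
    (sortedBy-sorted r (initial u j)) (sortedBy-sorted r (initial v j))
    (trans (length-sortedBy-initial r u j) (trans (length-initial j) (sym (length-sortedBy-initial r v j))))
    dominance
    where
    dominance : ∀ y → count (λ z → rank r z ≤ᵇ rank r y) (sortedBy r (initial v j))
                    ≤ count (λ z → rank r z ≤ᵇ rank r y) (sortedBy r (initial u j))
    dominance y = subst₂ _≤_ (sym (count-sortedBy-initial r v j C)) (sym (count-sortedBy-initial r u j C))
      (+-cancelʳ-≤ (φ j (toℕ r)) _ _ (begin
        count C (initial v j) + φ j (toℕ r)         ≤⟨ +-monoʳ-≤ (count C (initial v j)) φ-min ⟩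
        count C (initial v j) + φ j (suc (toℕ y))   ≡⟨ balance ⟨
        count C (initial u j) + φ j (toℕ r)         ∎))
      where
      open ≤-Reasoning
      C : Fin n → Bool
      C z = rank r z ≤ᵇ rank r y
      φ-min : φ j (toℕ r) ≤ φ j (suc (toℕ y))
      φ-min = minimum-periodic (φ j) (potential-periodic (initial u j) (initial v j) (length-initial j))
        {r} r-min (suc (toℕ y)) (toℕ<n y)
      balance : count C (initial u j) + φ j (toℕ r) ≡ count C (initial v j) + φ j (suc (toℕ y))
      balance = potential-balance C (toℕ y <ᵇ toℕ r) (toℕ r) (suc (toℕ y)) (λ x → rank-identity r x y)
        (initial u j) (initial v j) (length-initial j)

  equal-levels⇒countCyc≡ : ∀ j a b → φ j (toℕ a) ≡ φ j (toℕ b) →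
    countCyc a b (initial u j) ≡ countCyc a b (initial v j)
  equal-levels⇒countCyc≡ j a b same-level =
    +-cancelʳ-≡ (φ j (toℕ a)) (countCyc a b (initial u j)) (countCyc a b (initial v j)) (begin
      countCyc a b (initial u j) + φ j (toℕ a)   ≡⟨ balance ⟩
      countCyc a b (initial v j) + φ j (toℕ b)   ≡⟨ cong (countCyc a b (initial v j) +_) same-level ⟨
      countCyc a b (initial v j) + φ j (toℕ a)   ∎)
    where
    open ≡-Reasoning
    balance : countCyc a b (initial u j) + φ j (toℕ a) ≡ countCyc a b (initial v j) + φ j (toℕ b)
    balance = potential-balance (inCyc a b) _ (toℕ a) (toℕ b) (inCyc-identity a b)
      (initial u j) (initial v j) (length-initial j)

  a : Fin n → Fin n
  a k = argmin (λ t → φ (toℕ k) (toℕ t) + φ (suc (toℕ k)) (toℕ t)) k (allFin n)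

  a-minimises : ∀ k → Minimises (φ (toℕ k)) (a k) × Minimises (φ (suc (toℕ k))) (a k)
  a-minimises k = common-minimiser (φ (toℕ k) ∘ toℕ) (φ (suc (toℕ k)) ∘ toℕ) (increment ∘ toℕ)
    (φ-step ∘ toℕ)
    (λ s t → increment-oscillation _ _ (toℕ s) (toℕ t))
    (a k) (λ t → All.lookup (f[argmin]≤f[xs] k (allFin n)) (∈-allFin t))
    where
    increment : ℕ → ℕ
    increment t = ⟦ toℕ (u ⟨$⟩ʳ k) <ᵇ t ⟧ + ⟦ not (toℕ (v ⟨$⟩ʳ k) <ᵇ t) ⟧
    φ-step : ∀ t → φ (suc (toℕ k)) t ≡ φ (toℕ k) t + increment t
    φ-step t = trans (cong₂ _+_ (count-initial-suc u _ k) (count-initial-suc v _ k))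
      (interchange (count _ (initial u (toℕ k))) _ _ _)

  gale : ∀ k → GaleLe (a k) (prefix u k) (prefix v k)
  gale k = subst₂ (GaleLe (a k)) (sym (prefix≡initial u k)) (sym (prefix≡initial v k))
    (minimiser⇒GaleLe (suc (toℕ k)) (a k) (proj₂ (a-minimises k)))

  cyclic : ∀ k k′ → toℕ k′ ≡ suc (toℕ k) →
    countCyc (a k) (a k′) (prefix u k) ≡ countCyc (a k) (a k′) (prefix v k)
  cyclic k k′ k′≡1+k =
    subst₂ (λ S T → countCyc (a k) (a k′) S ≡ countCyc (a k) (a k′) T)
      (sym (prefix≡initial u k)) (sym (prefix≡initial v k))
      (equal-levels⇒countCyc≡ (suc (toℕ k)) (a k) (a k′) (≤-antisym
        (proj₂ (a-minimises k) (a k′))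
        (subst (λ i → Minimises (φ i) (a k′)) k′≡1+k (proj₁ (a-minimises k′)) (a k))))

-- Defs's _≤⟨_⟩_ would clash with the ≤-Reasoning syntax used above.
open Defs using (_≤⟨_⟩_)

theorem3p12 : ∀ (n : ℕ) (u v : Permutation′ n) →
    (∃ λ (a : Fin n → Fin n) → u ≤⟨ a ⟩ v) × (∃ λ (a : Fin n → Fin n) → u ≲⟨ a ⟩ v)
theorem3p12 n u v = (a , gale) , (a , gale , cyclic)
  where open Construction u v
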